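{- Let $n$ and $k$ be integers with $n-1>k\ge 3$, $k$ odd and $n$ even, and let $H_{k,n}$ be the Harary graph. (i) If $k+1<n\le 3k-1$, then $\mathrm{diam}(H_{k,n})=2$, every vertex $x$ satisfies $W(x,H_{k,n})=2n-k-2$, and $W(H_{k,n})=\frac{1}{2}n(2n-k-2)$. (ii) If $n\ge 3k+1$, then $\mathrm{diam}(H_{k,n})\ge 3$; more precisely, $\mathrm{diam}(H_{k,n})=D=\lfloor \frac{n-k-3}{2(k-1)}\rfloor+2$, every vertex $x$ satisfies \[W(x,H_{k,n})=\tfrac{1}{2}D\,(2n+4k-8-2(k-1)D)-(k-2),\] and \[W(H_{k,n})=\tfrac{1}{4}\,n\,D\,(2n+4k-8-2(k-1)D)-\tfrac{1}{2}n(k-2).\]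
   Context: For $n>k\ge 3$ with $k$ odd and $n$ even, the Harary graph $H_{k,n}$ has vertex set $\{0,1,\dots,n-1\}$ placed in this order around a circle; each vertex is adjacent to the nearest $(k-1)/2$ vertices in each direction around the circle and to the diametrically opposite vertex (vertex $i$ is adjacent to $i+n/2 \bmod n$). For a connected graph $G$, $d_G(x,y)$ is the length of a shortest $x$–$y$ path; $\mathrm{diam}(G)$ is the maximum distance between two vertices; the status of a vertex is $W(x,G)=\sum_{y\in V(G)} d_G(x,y)$; the Wiener index is $W(G)=\sum_{\{x,y\}\subseteq V(G)} d_G(x,y)$, the sum over unordered pairs of distinct vertices. -}

module Defs where

open import Data.Nat using (ℕ; zero; suc; _+_; _*_; _∸_; _≤_; _<_; ∣_-_∣; _⊓_)
open import Data.Nat.DivMod using (_/_; _%_)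
open import Data.Fin using (Fin; toℕ)
open import Data.Product using (Σ; _×_; ∃-syntax)
open import Data.Sum using (_⊎_)
open import Data.Bool using (if_then_else_)
open import Data.Nat using (_<ᵇ_)
open import Relation.Binary.PropositionalEquality using (_≡_)

circ : ℕ → ℕ → ℕ → ℕ
circ n i j = ∣ i - j ∣ ⊓ (n ∸ ∣ i - j ∣)

-- Adjacency of the Harary graph H_{k,n} (k odd, n even) on vertex set Fin n:
-- i ~ j iff i ≠ j and they are within (k-1)/2 steps around the circle,
-- or j is the diametrically opposite vertex i + n/2 mod n.
HararyAdj : (k n : ℕ) → Fin n → Fin n → Set
HararyAdj k zero i j = Data.Empty.⊥ where import Data.Empty
HararyAdj k (suc m) i j =
  (0 < circ (suc m) (toℕ i) (toℕ j) × circ (suc m) (toℕ i) (toℕ j) ≤ (k ∸ 1) / 2)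
  ⊎ (toℕ j ≡ (toℕ i + suc m / 2) % suc m)

data Walk {V : Set} (E : V → V → Set) : V → V → ℕ → Set where
  nil  : ∀ {x} → Walk E x x 0
  cons : ∀ {x y z l} → E x y → Walk E y z l → Walk E x z (suc l)

IsDist : {V : Set} (E : V → V → Set) → V → V → ℕ → Set
IsDist E x y d = Walk E x y d × (∀ m → Walk E x y m → d ≤ m)

sumFin : (n : ℕ) → (Fin n → ℕ) → ℕ
sumFin zero f = 0
sumFin (suc n) f = f Fin.zero + sumFin n (λ i → f (Fin.suc i))
  where import Data.Fin as Fin

IsDiam : {n : ℕ} (E : Fin n → Fin n → Set) → ℕ → Set
IsDiam E D = (∃[ x ] ∃[ y ] IsDist E x y D) × (∀ x y d → IsDist E x y d → d ≤ D)

IsStatus : {n : ℕ} (E : Fin n → Fin n → Set) → Fin n → ℕ → Set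
IsStatus {n} E x S = Σ (Fin n → ℕ) λ f → (∀ y → IsDist E x y (f y)) × S ≡ sumFin n f

-- W(G) = W : sum of distances over unordered pairs {x,y}, x ≠ y
-- (enumerated as pairs with toℕ x < toℕ y).
IsWiener : {n : ℕ} (E : Fin n → Fin n → Set) → ℕ → Set
IsWiener {n} E W = Σ (Fin n → Fin n → ℕ) λ d → (∀ x y → IsDist E x y (d x y)) ×
  W ≡ sumFin n (λ x → sumFin n (λ y → if toℕ x <ᵇ toℕ y then d x y else 0))

-- D = ⌊(n-k-3)/(2(k-1))⌋ + 2  (only used for k ≥ 3).
harD : ℕ → ℕ → ℕ
harD n zero = 0
harD n (suc zero) = 0
harD n (suc (suc i)) = (n ∸ suc (suc i) ∸ 3) / (2 * suc i) + 2

module Submission where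

-- Write k = 2r + 1 and n = 2m. A vertex is adjacent to the vertices within circular distance r
-- and to its antipode, so a vertex at circular distance c from z should be at graph distance
-- δ c = min (⌈c/r⌉, 1 + ⌈(m − c)/r⌉) from z, walking along the circle or jumping across first.
-- Indeed δ drops by at most one along an edge, giving the lower bound, and every vertex with
-- δ > 0 has a neighbour where δ is smaller, giving the upper bound. Hence all statuses equal
-- Σ_c δ(circ c) and 2W = n·status. Writing m − (r + 2) = 2rq + e with e < 2r, δ equals ⌈c/r⌉
-- up to A = (q + 1)r + 1, then q + 2 on the next e + 1 points, then 1 + ⌈(m − c)/r⌉; so the
-- diameter is q + 2 and the sum has a closed form. Case (i) is exactly q = 0.

open import Defs
open import Data.Nat using (ℕ; _+_; _*_; _∸_; _≤_; _<_)
open import Data.Nat.Divisibility using (_∣_)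
open import Data.Integer using (ℤ; +_) renaming (_*_ to _*ℤ_; _-_ to _-ℤ_; _+_ to _+ℤ_)
open import Data.Product using (_×_; ∃-syntax)
open import Data.Fin using (Fin)
open import Relation.Nullary using (¬_)
open import Relation.Binary.PropositionalEquality using (_≡_)

open import Data.Nat
open import Data.Nat.Properties
open import Data.Nat.DivMod
open import Data.Nat.Divisibility using (divides; m%n≡0⇒n∣m)
open import Data.Fin using (toℕ; fromℕ<) renaming (zero to fzero; suc to fsuc)
open import Data.Fin.Properties using (toℕ<n; toℕ-fromℕ<; toℕ-injective)
open import Data.Product using (_,_; proj₁; proj₂)
open import Data.Sum using (_⊎_; inj₁; inj₂)
open import Data.Bool using (true; false; if_then_else_; T)
open import Data.Empty using (⊥-elim)
open import Data.Unit using (tt)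
open import Relation.Nullary using (yes; no)
open import Relation.Binary.Definitions using (tri<; tri≈; tri>)
open import Relation.Binary.PropositionalEquality
open import Data.Nat.Tactic.RingSolver using (solve-∀)
import Data.Integer.Properties as ℤ
import Data.Integer.Tactic.RingSolver as ℤ-Solver

m≡n+o⇒m∸n≡o : ∀ {m} n {o} → m ≡ n + o → m ∸ n ≡ o
m≡n+o⇒m∸n≡o n {o} refl = m+n∸m≡n n o

∣m+n-m∣≡n : ∀ m n → ∣ m + n - m ∣ ≡ n
∣m+n-m∣≡n m n = trans (∣-∣-comm (m + n) m) (∣m-m+n∣≡n m n)

∣m+n-n∣≡m : ∀ m n → ∣ m + n - n ∣ ≡ m
∣m+n-n∣≡m m n = trans (cong (λ x → ∣ x - n ∣) (+-comm m n)) (∣m+n-m∣≡n n m)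

x≤⊓+⊓ : ∀ {x} a b c d → x ≤ a + c → x ≤ a + d → x ≤ b + c → x ≤ b + d → x ≤ a ⊓ b + c ⊓ d
x≤⊓+⊓ a b c d ac ad bc bd with ⊓-sel a b | ⊓-sel c d
... | inj₁ a⊓b≡a | inj₁ c⊓d≡c rewrite a⊓b≡a | c⊓d≡c = ac
... | inj₁ a⊓b≡a | inj₂ c⊓d≡d rewrite a⊓b≡a | c⊓d≡d = ad
... | inj₂ a⊓b≡b | inj₁ c⊓d≡c rewrite a⊓b≡b | c⊓d≡c = bc
... | inj₂ a⊓b≡b | inj₂ c⊓d≡d rewrite a⊓b≡b | c⊓d≡d = bd

⊓≡ : ∀ {x a b} → x ≤ a → x ≤ b → a ≤ x ⊎ b ≤ x → a ⊓ b ≡ x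
⊓≡ x≤a x≤b (inj₁ a≤x) = trans (m≤n⇒m⊓n≡m (≤-trans a≤x x≤b)) (≤-antisym a≤x x≤a)
⊓≡ x≤a x≤b (inj₂ b≤x) = trans (m≥n⇒m⊓n≡n (≤-trans b≤x x≤a)) (≤-antisym b≤x x≤b)

-- Circular distance

cyc : ℕ → ℕ → ℕ
cyc N d = d ⊓ (N ∸ d)

cyc≤ : ∀ N d → cyc N d ≤ d
cyc≤ N d = m⊓n≤m d (N ∸ d)

cyc≤∸ : ∀ N d → cyc N d ≤ N ∸ d
cyc≤∸ N d = m⊓n≤n d (N ∸ d)

m+m∸d≤m : ∀ m d → m ≤ d → m + m ∸ d ≤ m
m+m∸d≤m m d m≤d = subst (m + m ∸ d ≤_) (m+n∸n≡m m m) (∸-monoʳ-≤ (m + m) m≤d)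

cyc-below-half : ∀ m d → d ≤ m → cyc (m + m) d ≡ d
cyc-below-half m d d≤m = m≤n⇒m⊓n≡m (≤-trans d≤m (subst (_≤ m + m ∸ d) (m+n∸n≡m m m) (∸-monoʳ-≤ (m + m) d≤m)))

cyc-above-half : ∀ m d → m ≤ d → cyc (m + m) d ≡ m + m ∸ d
cyc-above-half m d m≤d = m≥n⇒m⊓n≡n (≤-trans (m+m∸d≤m m d m≤d) m≤d)

cyc≤half : ∀ m d → cyc (m + m) d ≤ m
cyc≤half m d with ≤-total d m
... | inj₁ d≤m = ≤-trans (cyc≤ (m + m) d) d≤m
... | inj₂ m≤d = ≤-trans (cyc≤∸ (m + m) d) (m+m∸d≤m m d m≤d)

cyc-subadditive : ∀ N d₁ d₂ → cyc N (d₁ + d₂) ≤ cyc N d₁ + cyc N d₂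
cyc-subadditive N d₁ d₂ = x≤⊓+⊓ d₁ (N ∸ d₁) d₂ (N ∸ d₂)
  (cyc≤ N _)
  (≤-trans (cyc≤∸ N _) (≤-trans (∸-monoʳ-≤ N (m≤n+m d₂ d₁)) (m≤n+m _ d₁)))
  (≤-trans (cyc≤∸ N _) (≤-trans (∸-monoʳ-≤ N (m≤m+n d₁ d₂)) (m≤m+n _ d₂)))
  (≤-trans (cyc≤∸ N _) (≤-trans (∸-monoʳ-≤ N (m≤m+n d₁ d₂)) (m≤m+n _ _)))

-- Subadditivity for D ≡ (N ∸ d₁) + (d₁ + D) modulo N.
cyc-subadditive-mod : ∀ d₁ D t → let N = d₁ + D + t in cyc N D ≤ cyc N d₁ + cyc N (d₁ + D)
cyc-subadditive-mod d₁ D t = x≤⊓+⊓ d₁ (N ∸ d₁) (d₁ + D) (N ∸ (d₁ + D))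
  (≤-trans (cyc≤ N D) (≤-trans (m≤n+m D d₁) (m≤n+m _ d₁)))
  (subst (λ x → cyc N D ≤ d₁ + x) (sym N∸[d₁+D]≡t) (≤-trans (cyc≤∸ N D) (≤-reflexive N∸D≡d₁+t)))
  (≤-trans (cyc≤ N D) (≤-trans (m≤n+m D d₁) (m≤n+m _ (N ∸ d₁))))
  (subst (λ x → cyc N D ≤ x + (N ∸ (d₁ + D))) (sym N∸d₁≡D+t) (≤-trans (cyc≤ N D) (≤-trans (m≤m+n D t) (m≤m+n _ _))))
  where
  N = d₁ + D + t
  N∸d₁≡D+t : N ∸ d₁ ≡ D + t
  N∸d₁≡D+t = m≡n+o⇒m∸n≡o d₁ (+-assoc d₁ D t)
  N∸[d₁+D]≡t : N ∸ (d₁ + D) ≡ t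
  N∸[d₁+D]≡t = m≡n+o⇒m∸n≡o (d₁ + D) refl
  N∸D≡d₁+t : N ∸ D ≡ d₁ + t
  N∸D≡d₁+t = m≡n+o⇒m∸n≡o D (rearrange d₁ D t)
    where
    rearrange : ∀ a b c → a + b + c ≡ b + (a + c)
    rearrange = solve-∀

circ-comm : ∀ N a b → circ N a b ≡ circ N b a
circ-comm N a b = cong (cyc N) (∣-∣-comm a b)

circ≤half : ∀ m a b → circ (m + m) a b ≤ m
circ≤half m a b = cyc≤half m ∣ a - b ∣

∣m-n∣<o : ∀ {m n o} → m < o → n < o → ∣ m - n ∣ < o
∣m-n∣<o {m} {n} m<o n<o with ≤-total m n
... | inj₁ m≤n = ≤-<-trans (≤-trans (≤-reflexive (m≤n⇒∣m-n∣≡n∸m m≤n)) (m∸n≤m n m)) n<o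
... | inj₂ n≤m = ≤-<-trans (≤-trans (≤-reflexive (m≤n⇒∣n-m∣≡n∸m n≤m)) (m∸n≤m m n)) m<o

circ≡0⇒≡ : ∀ N a b → a < N → b < N → circ N a b ≡ 0 → a ≡ b
circ≡0⇒≡ N a b a<N b<N eq with ⊓-sel ∣ a - b ∣ (N ∸ ∣ a - b ∣)
... | inj₁ e = ∣m-n∣≡0⇒m≡n (trans (sym e) eq)
... | inj₂ e = ⊥-elim (<⇒≱ (∣m-n∣<o a<N b<N) (m∸n≡0⇒m≤n (trans (sym e) eq)))

reflect : ℕ → ℕ → ℕ
reflect N x = N ∸ 1 ∸ x

reflect< : ∀ N x → 0 < N → reflect N x < N
reflect< (suc N) x _ = s≤s (m∸n≤m N x)

reflect-involutive : ∀ N x → x < N → reflect N (reflect N x) ≡ x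
reflect-involutive (suc N) x (s≤s x≤N) = m∸[m∸n]≡n x≤N

∣[L∸a]-[L∸b]∣≡∣a-b∣-ordered : ∀ L a b → a ≤ b → b ≤ L → ∣ (L ∸ a) - (L ∸ b) ∣ ≡ ∣ a - b ∣
∣[L∸a]-[L∸b]∣≡∣a-b∣-ordered L a b a≤b b≤L with m≤n⇒∃[o]m+o≡n a≤b | m≤n⇒∃[o]m+o≡n b≤L
... | d , refl | t , refl = begin
  ∣ (a + d + t ∸ a) - (a + d + t ∸ (a + d)) ∣
    ≡⟨ cong₂ ∣_-_∣ (m≡n+o⇒m∸n≡o a (+-assoc a d t)) (m≡n+o⇒m∸n≡o (a + d) refl) ⟩
  ∣ d + t - t ∣ ≡⟨ ∣m+n-n∣≡m d t ⟩
  d             ≡⟨ ∣m-m+n∣≡n a d ⟨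
  ∣ a - a + d ∣ ∎
  where open ≡-Reasoning

∣[L∸a]-[L∸b]∣≡∣a-b∣ : ∀ L a b → a ≤ L → b ≤ L → ∣ (L ∸ a) - (L ∸ b) ∣ ≡ ∣ a - b ∣
∣[L∸a]-[L∸b]∣≡∣a-b∣ L a b a≤L b≤L with ≤-total a b
... | inj₁ a≤b = ∣[L∸a]-[L∸b]∣≡∣a-b∣-ordered L a b a≤b b≤L
... | inj₂ b≤a = begin
  ∣ (L ∸ a) - (L ∸ b) ∣ ≡⟨ ∣-∣-comm (L ∸ a) (L ∸ b) ⟩
  ∣ (L ∸ b) - (L ∸ a) ∣ ≡⟨ ∣[L∸a]-[L∸b]∣≡∣a-b∣-ordered L b a b≤a a≤L ⟩
  ∣ b - a ∣             ≡⟨ ∣-∣-comm b a ⟩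
  ∣ a - b ∣             ∎
  where open ≡-Reasoning

circ-reflect : ∀ N a b → a < N → b < N → circ N (reflect N a) (reflect N b) ≡ circ N a b
circ-reflect N a b a<N b<N = cong (cyc N) (∣[L∸a]-[L∸b]∣≡∣a-b∣ (N ∸ 1) a b (≤pred a<N) (≤pred b<N))
  where
  ≤pred : ∀ {x} → x < N → x ≤ N ∸ 1
  ≤pred {x} x<N = subst (x ≤_) (sym (pred[m∸n]≡m∸[1+n] N 0)) (<⇒≤pred x<N)

circ-triangle-sym : ∀ N a b c → circ N c a ≤ circ N c b + circ N b a → circ N a c ≤ circ N a b + circ N b c
circ-triangle-sym N a b c h = subst₂ _≤_ (circ-comm N c a)
  (trans (+-comm (circ N c b) (circ N b a)) (cong₂ _+_ (circ-comm N b a) (circ-comm N c b))) h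

circ-triangle-between : ∀ N a b c → a ≤ b → b ≤ c → circ N a c ≤ circ N a b + circ N b c
circ-triangle-between N a b c a≤b b≤c with m≤n⇒∃[o]m+o≡n a≤b | m≤n⇒∃[o]m+o≡n b≤c
... | d₁ , refl | d₂ , refl = begin
  cyc N ∣ a - a + d₁ + d₂ ∣   ≡⟨ cong (λ x → cyc N ∣ a - x ∣) (+-assoc a d₁ d₂) ⟩
  cyc N ∣ a - a + (d₁ + d₂) ∣ ≡⟨ cong (cyc N) (∣m-m+n∣≡n a (d₁ + d₂)) ⟩
  cyc N (d₁ + d₂)             ≤⟨ cyc-subadditive N d₁ d₂ ⟩
  cyc N d₁ + cyc N d₂         ≡⟨ cong₂ (λ x y → cyc N x + cyc N y) (∣m-m+n∣≡n a d₁) (∣m-m+n∣≡n (a + d₁) d₂) ⟨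
  circ N a (a + d₁) + circ N (a + d₁) (a + d₁ + d₂) ∎
  where open ≤-Reasoning

circ-triangle-below : ∀ N a b c → c < N → b ≤ a → a ≤ c → circ N a c ≤ circ N a b + circ N b c
circ-triangle-below N a b c c<N b≤a a≤c with m≤n⇒∃[o]m+o≡n b≤a | m≤n⇒∃[o]m+o≡n a≤c
... | d₁ , refl | D , refl
  with m≤n⇒∃[o]m+o≡n (≤-trans (m≤n+m (d₁ + D) b) (≤-trans (≤-reflexive (sym (+-assoc b d₁ D))) (<⇒≤ c<N)))
...   | t , refl = begin
  circ M (b + d₁) (b + d₁ + D) ≡⟨ cong (cyc M) (∣m-m+n∣≡n (b + d₁) D) ⟩
  cyc M D                      ≤⟨ cyc-subadditive-mod d₁ D t ⟩
  cyc M d₁ + cyc M (d₁ + D)    ≡⟨ cong₂ (λ x y → cyc M x + cyc M y) (∣m+n-m∣≡n b d₁) ∣b-b+d₁+D∣≡d₁+D ⟨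
  circ M (b + d₁) b + circ M b (b + d₁ + D) ∎
  where
  open ≤-Reasoning
  M = d₁ + D + t
  ∣b-b+d₁+D∣≡d₁+D : ∣ b - b + d₁ + D ∣ ≡ d₁ + D
  ∣b-b+d₁+D∣≡d₁+D = trans (cong (λ x → ∣ b - x ∣) (+-assoc b d₁ D)) (∣m-m+n∣≡n b (d₁ + D))

circ-triangle-above : ∀ N a b c → a < N → b < N → c < N → a ≤ c → c ≤ b → circ N a c ≤ circ N a b + circ N b c
circ-triangle-above N a b c a<N b<N c<N a≤c c≤b = circ-triangle-sym N a b c
  (subst₂ _≤_ (circ-reflect N c a c<N a<N) (cong₂ _+_ (circ-reflect N c b c<N b<N) (circ-reflect N b a b<N a<N))
    (circ-triangle-below N (reflect N c) (reflect N b) (reflect N a) (reflect< N a 0<N)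
      (∸-monoʳ-≤ (N ∸ 1) c≤b) (∸-monoʳ-≤ (N ∸ 1) a≤c)))
  where
  0<N : 0 < N
  0<N = ≤-<-trans z≤n a<N

circ-triangle-ordered : ∀ N a b c → a < N → b < N → c < N → a ≤ c → circ N a c ≤ circ N a b + circ N b c
circ-triangle-ordered N a b c a<N b<N c<N a≤c with ≤-total b a | ≤-total b c
... | inj₁ b≤a | _         = circ-triangle-below N a b c c<N b≤a a≤c
... | inj₂ a≤b | inj₁ b≤c  = circ-triangle-between N a b c a≤b b≤c
... | inj₂ a≤b | inj₂ c≤b  = circ-triangle-above N a b c a<N b<N c<N a≤c c≤b

circ-triangle : ∀ N a b c → a < N → b < N → c < N → circ N a c ≤ circ N a b + circ N b c
circ-triangle N a b c a<N b<N c<N with ≤-total a c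
... | inj₁ a≤c = circ-triangle-ordered N a b c a<N b<N c<N a≤c
... | inj₂ c≤a = circ-triangle-sym N a b c (circ-triangle-ordered N c b a c<N b<N a<N c≤a)

cyc[m+d]≡m∸d : ∀ m d → cyc (m + m) (m + d) ≡ m ∸ d
cyc[m+d]≡m∸d m d = trans (cyc-above-half m (m + d) (m≤m+n m d)) ([m+n]∸[m+o]≡n∸o m m d)

cyc∣m-d∣≡m∸cyc-d : ∀ m d → d ≤ m + m → cyc (m + m) ∣ m - d ∣ ≡ m ∸ cyc (m + m) d
cyc∣m-d∣≡m∸cyc-d m d d≤2m with ≤-total d m
... | inj₁ d≤m = begin
  cyc (m + m) ∣ m - d ∣ ≡⟨ cong (cyc (m + m)) (m≤n⇒∣n-m∣≡n∸m d≤m) ⟩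
  cyc (m + m) (m ∸ d)   ≡⟨ cyc-below-half m (m ∸ d) (m∸n≤m m d) ⟩
  m ∸ d                 ≡⟨ cong (m ∸_) (cyc-below-half m d d≤m) ⟨
  m ∸ cyc (m + m) d     ∎
  where open ≡-Reasoning
... | inj₂ m≤d with m≤n⇒∃[o]m+o≡n m≤d
...   | e , refl = begin
  cyc (m + m) ∣ m - m + e ∣ ≡⟨ cong (cyc (m + m)) (∣m-m+n∣≡n m e) ⟩
  cyc (m + m) e             ≡⟨ cyc-below-half m e e≤m ⟩
  e                         ≡⟨ m∸[m∸n]≡n e≤m ⟨
  m ∸ (m ∸ e)               ≡⟨ cong (m ∸_) (cyc[m+d]≡m∸d m e) ⟨
  m ∸ cyc (m + m) (m + e)   ∎
  where
  open ≡-Reasoning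
  e≤m : e ≤ m
  e≤m = +-cancelˡ-≤ m e m d≤2m

circ-antipode-< : ∀ m a b → a < m → b < m + m → circ (m + m) (a + m) b ≡ m ∸ circ (m + m) a b
circ-antipode-< m a b a<m b<2m with ≤-total b a
... | inj₁ b≤a with m≤n⇒∃[o]m+o≡n b≤a
...   | d , refl = begin
  cyc (m + m) ∣ b + d + m - b ∣ ≡⟨ cong (cyc (m + m)) (trans (cong (λ x → ∣ x - b ∣) (+-assoc b d m)) (∣m+n-m∣≡n b (d + m))) ⟩
  cyc (m + m) (d + m)           ≡⟨ cong (cyc (m + m)) (+-comm d m) ⟩
  cyc (m + m) (m + d)           ≡⟨ cyc[m+d]≡m∸d m d ⟩
  m ∸ d                         ≡⟨ cong (m ∸_) (trans (cong (cyc (m + m)) (∣m+n-m∣≡n b d)) (cyc-below-half m d d≤m)) ⟨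
  m ∸ cyc (m + m) ∣ b + d - b ∣ ∎
  where
  open ≡-Reasoning
  d≤m : d ≤ m
  d≤m = ≤-trans (m≤n+m d b) (<⇒≤ a<m)
circ-antipode-< m a b a<m b<2m | inj₂ a≤b with m≤n⇒∃[o]m+o≡n a≤b
...   | d , refl = begin
  cyc (m + m) ∣ a + m - a + d ∣ ≡⟨ cong (cyc (m + m)) (∣m+n-m+o∣≡∣n-o∣ a m d) ⟩
  cyc (m + m) ∣ m - d ∣         ≡⟨ cyc∣m-d∣≡m∸cyc-d m d (<⇒≤ (≤-<-trans (m≤n+m d a) b<2m)) ⟩
  m ∸ cyc (m + m) d             ≡⟨ cong (λ x → m ∸ cyc (m + m) x) (∣m-m+n∣≡n a d) ⟨
  m ∸ cyc (m + m) ∣ a - a + d ∣ ∎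
  where open ≡-Reasoning

circ-antipode : ∀ m a b .{{_ : NonZero (m + m)}} → a < m + m → b < m + m →
  circ (m + m) ((a + m) % (m + m)) b ≡ m ∸ circ (m + m) a b
circ-antipode m a b a<2m b<2m with a <? m
... | yes a<m rewrite m<n⇒m%n≡m (+-monoˡ-< m a<m) = circ-antipode-< m a b a<m b<2m
... | no a≮m with m≤n⇒∃[o]m+o≡n (≮⇒≥ a≮m)
...   | a′ , refl = begin
  circ (m + m) ((m + a′ + m) % (m + m)) b ≡⟨ cong (λ x → circ (m + m) x b) [m+a′+m]%[m+m]≡a′ ⟩
  circ (m + m) a′ b                       ≡⟨ m∸[m∸n]≡n (circ≤half m a′ b) ⟨
  m ∸ (m ∸ circ (m + m) a′ b)             ≡⟨ cong (m ∸_) (circ-antipode-< m a′ b a′<m b<2m) ⟨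
  m ∸ circ (m + m) (a′ + m) b             ≡⟨ cong (λ x → m ∸ circ (m + m) x b) (+-comm a′ m) ⟩
  m ∸ circ (m + m) (m + a′) b             ∎
  where
  open ≡-Reasoning
  a′<m : a′ < m
  a′<m = +-cancelˡ-< m a′ m a<2m
  rearrange : ∀ m a′ → m + a′ + m ≡ a′ + 1 * (m + m)
  rearrange = solve-∀
  [m+a′+m]%[m+m]≡a′ : (m + a′ + m) % (m + m) ≡ a′
  [m+a′+m]%[m+m]≡a′ = trans (cong (_% (m + m)) (rearrange m a′))
    (trans ([m+kn]%n≡m%n a′ 1 (m + m)) (m<n⇒m%n≡m (<-≤-trans a′<m (m≤m+n m m))))

m∸[n+o]+n≡m∸o : ∀ m n o → n + o ≤ m → m ∸ (n + o) + n ≡ m ∸ o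
m∸[n+o]+n≡m∸o m n o n+o≤m = begin
  m ∸ (n + o) + n ≡⟨ cong (λ x → m ∸ x + n) (+-comm n o) ⟩
  m ∸ (o + n) + n ≡⟨ cong (_+ n) (∸-+-assoc m o n) ⟨
  m ∸ o ∸ n + n   ≡⟨ m∸n+n≡m (m+n≤o⇒m≤o∸n n n+o≤m) ⟩
  m ∸ o           ∎
  where open ≡-Reasoning

circ-below-half : ∀ m a d → d ≤ m → circ (m + m) a (a + d) ≡ d
circ-below-half m a d d≤m = trans (cong (cyc (m + m)) (∣m-m+n∣≡n a d)) (cyc-below-half m d d≤m)

circ-above-half : ∀ m a d → m ≤ d → circ (m + m) a (a + d) ≡ m + m ∸ d
circ-above-half m a d m≤d = trans (cong (cyc (m + m)) (∣m-m+n∣≡n a d)) (cyc-above-half m d m≤d)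

StepToward : ℕ → ℕ → ℕ → ℕ → Set
StepToward N a b r = ∃[ w ] w < N × circ N a w ≡ r × circ N w b + r ≤ circ N a b

step-toward-forward : ∀ m a d r → d ≤ m → r < d → a + d < m + m → StepToward (m + m) a (a + d) r
step-toward-forward m a d r d≤m r<d a+d<N =
  a + r , <-trans (+-monoʳ-< a r<d) a+d<N , circ-below-half m a r (≤-trans (<⇒≤ r<d) d≤m) , (begin
    cyc N ∣ a + r - a + d ∣ + r ≡⟨ cong (λ x → cyc N x + r) (trans (∣m+n-m+o∣≡∣n-o∣ a r d) (m≤n⇒∣m-n∣≡n∸m (<⇒≤ r<d))) ⟩
    cyc N (d ∸ r) + r           ≤⟨ +-monoˡ-≤ r (cyc≤ N (d ∸ r)) ⟩
    d ∸ r + r                   ≡⟨ m∸n+n≡m (<⇒≤ r<d) ⟩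
    d                           ≡⟨ circ-below-half m a d d≤m ⟨
    circ N a (a + d)            ∎)
  where
  open ≤-Reasoning
  N = m + m

-- The shorter arc from a to a + d passes through 0, so w lies r steps below a (mod N).
step-toward-backward : ∀ m a d r → m ≤ d → r < m + m ∸ d → a + d < m + m → StepToward (m + m) a (a + d) r
step-toward-backward m a d r m≤d r<N∸d a+d<N with r ≤? a
... | yes r≤a with m≤n⇒∃[o]m+o≡n r≤a
...   | a₀ , refl =
  a₀ , ≤-<-trans (m≤n+m a₀ r) (≤-<-trans (m≤m+n (r + a₀) d) a+d<N)
  , trans (cong (cyc N) (∣m+n-n∣≡m r a₀)) (cyc-below-half m r r≤m)
  , (begin
    cyc N ∣ a₀ - r + a₀ + d ∣ + r ≡⟨ cong (λ x → cyc N ∣ a₀ - x ∣ + r) (rearrange r a₀ d) ⟩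
    cyc N ∣ a₀ - a₀ + (r + d) ∣ + r ≡⟨ cong (λ x → cyc N x + r) (∣m-m+n∣≡n a₀ (r + d)) ⟩
    cyc N (r + d) + r           ≤⟨ +-monoˡ-≤ r (cyc≤∸ N (r + d)) ⟩
    N ∸ (r + d) + r             ≡⟨ m∸[n+o]+n≡m∸o N r d r+d≤N ⟩
    N ∸ d                       ≡⟨ circ-above-half m (r + a₀) d m≤d ⟨
    circ N (r + a₀) (r + a₀ + d) ∎)
  where
  open ≤-Reasoning
  N = m + m
  r≤m : r ≤ m
  r≤m = ≤-trans (<⇒≤ r<N∸d) (m+m∸d≤m m d m≤d)
  r+d≤N : r + d ≤ N
  r+d≤N = ≤-trans (+-monoˡ-≤ d (<⇒≤ r<N∸d)) (≤-reflexive (m∸n+n≡m (≤-trans (m≤n+m d (r + a₀)) (<⇒≤ a+d<N))))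
  rearrange : ∀ r a₀ d → r + a₀ + d ≡ a₀ + (r + d)
  rearrange = solve-∀
step-toward-backward m a d r m≤d r<N∸d a+d<N | no r≰a =
  a + (N ∸ r) , subst (a + (N ∸ r) <_) (m+[n∸m]≡n r≤N) (+-monoˡ-< (N ∸ r) (≰⇒> r≰a))
  , trans (circ-above-half m a (N ∸ r) m≤N∸r) (m∸[m∸n]≡n r≤N)
  , (begin
    cyc N ∣ a + (N ∸ r) - a + d ∣ + r ≡⟨ cong (λ x → cyc N x + r) (trans (∣m+n-m+o∣≡∣n-o∣ a (N ∸ r) d) (m≤n⇒∣n-m∣≡n∸m d≤N∸r)) ⟩
    cyc N (N ∸ r ∸ d) + r       ≤⟨ +-monoˡ-≤ r (cyc≤ N (N ∸ r ∸ d)) ⟩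
    N ∸ r ∸ d + r               ≡⟨ cong (_+ r) (∸-+-assoc N r d) ⟩
    N ∸ (r + d) + r             ≡⟨ m∸[n+o]+n≡m∸o N r d r+d≤N ⟩
    N ∸ d                       ≡⟨ circ-above-half m a d m≤d ⟨
    circ N a (a + d)            ∎)
  where
  open ≤-Reasoning
  N = m + m
  r≤m : r ≤ m
  r≤m = ≤-trans (<⇒≤ r<N∸d) (m+m∸d≤m m d m≤d)
  r≤N : r ≤ N
  r≤N = ≤-trans r≤m (m≤m+n m m)
  r+d≤N : r + d ≤ N
  r+d≤N = ≤-trans (+-monoˡ-≤ d (<⇒≤ r<N∸d)) (≤-reflexive (m∸n+n≡m (≤-trans (m≤n+m d a) (<⇒≤ a+d<N))))
  d≤N∸r : d ≤ N ∸ r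
  d≤N∸r = subst (_≤ N ∸ r) (m+n∸m≡n r d) (∸-monoˡ-≤ r r+d≤N)
  m≤N∸r : m ≤ N ∸ r
  m≤N∸r = subst (_≤ N ∸ r) (m+n∸n≡m m m) (∸-monoʳ-≤ N r≤m)

step-toward-ordered : ∀ m r a b → a ≤ b → b < m + m → r < circ (m + m) a b → StepToward (m + m) a b r
step-toward-ordered m r a b a≤b b<N r<c with m≤n⇒∃[o]m+o≡n a≤b
... | d , refl with ≤-total d m
...   | inj₁ d≤m = step-toward-forward m a d r d≤m (subst (r <_) (circ-below-half m a d d≤m) r<c) b<N
...   | inj₂ m≤d = step-toward-backward m a d r m≤d (subst (r <_) (circ-above-half m a d m≤d) r<c) b<N

StepToward-reflect : ∀ N a b r → a < N → b < N → StepToward N (reflect N a) (reflect N b) r → StepToward N a b r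
StepToward-reflect N a b r a<N b<N (w , w<N , ρa-w≡r , w-ρb+r≤ρa-ρb) =
  reflect N w , reflect< N w 0<N , a-ρw≡r , ρw-b+r≤a-b
  where
  0<N : 0 < N
  0<N = ≤-<-trans z≤n a<N
  a-ρw≡r : circ N a (reflect N w) ≡ r
  a-ρw≡r = begin
    circ N a (reflect N w)                         ≡⟨ cong (λ x → circ N x (reflect N w)) (reflect-involutive N a a<N) ⟨
    circ N (reflect N (reflect N a)) (reflect N w) ≡⟨ circ-reflect N (reflect N a) w (reflect< N a 0<N) w<N ⟩
    circ N (reflect N a) w                         ≡⟨ ρa-w≡r ⟩
    r                                              ∎
    where open ≡-Reasoning
  ρw-b+r≤a-b : circ N (reflect N w) b + r ≤ circ N a b
  ρw-b+r≤a-b = begin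
    circ N (reflect N w) b + r                         ≡⟨ cong (λ x → circ N (reflect N w) x + r) (reflect-involutive N b b<N) ⟨
    circ N (reflect N w) (reflect N (reflect N b)) + r ≡⟨ cong (_+ r) (circ-reflect N w (reflect N b) w<N (reflect< N b 0<N)) ⟩
    circ N w (reflect N b) + r                         ≤⟨ w-ρb+r≤ρa-ρb ⟩
    circ N (reflect N a) (reflect N b)                 ≡⟨ circ-reflect N a b a<N b<N ⟩
    circ N a b                                         ∎
    where open ≤-Reasoning

step-toward : ∀ m r a b → a < m + m → b < m + m → r < circ (m + m) a b → StepToward (m + m) a b r
step-toward m r a b a<N b<N r<c with ≤-total a b
... | inj₁ a≤b = step-toward-ordered m r a b a≤b b<N r<c
... | inj₂ b≤a = StepToward-reflect (m + m) a b r a<N b<N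
  (step-toward-ordered m r (reflect (m + m) a) (reflect (m + m) b) (∸-monoʳ-≤ (m + m ∸ 1) b≤a)
    (reflect< (m + m) b (≤-<-trans z≤n a<N)) (subst (r <_) (sym (circ-reflect (m + m) a b a<N b<N)) r<c))

-- Finite sums

sum< : ℕ → (ℕ → ℕ) → ℕ
sum< zero    F = 0
sum< (suc n) F = F 0 + sum< n (λ i → F (suc i))

sumFin-toℕ : ∀ n (F : ℕ → ℕ) → sumFin n (λ y → F (toℕ y)) ≡ sum< n F
sumFin-toℕ zero    F = refl
sumFin-toℕ (suc n) F = cong (_+_ (F 0)) (sumFin-toℕ n (λ i → F (suc i)))

sum<-+ : ∀ a b (F : ℕ → ℕ) → sum< (a + b) F ≡ sum< a F + sum< b (λ i → F (a + i))
sum<-+ zero    b F = refl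
sum<-+ (suc a) b F = trans (cong (_+_ (F 0)) (sum<-+ a b (λ i → F (suc i)))) (sym (+-assoc (F 0) _ _))

sum<-cong : ∀ n {F G : ℕ → ℕ} → (∀ i → i < n → F i ≡ G i) → sum< n F ≡ sum< n G
sum<-cong zero    F≡G = refl
sum<-cong (suc n) F≡G = cong₂ _+_ (F≡G 0 z<s) (sum<-cong n (λ i i<n → F≡G (suc i) (s≤s i<n)))

sum<-snoc : ∀ n (F : ℕ → ℕ) → sum< (suc n) F ≡ sum< n F + F n
sum<-snoc zero    F = +-comm (F 0) 0
sum<-snoc (suc n) F = trans (cong (_+_ (F 0)) (sum<-snoc n (λ i → F (suc i)))) (sym (+-assoc (F 0) _ _))

sum<-reverse : ∀ n (F : ℕ → ℕ) → sum< (suc n) (λ i → F (n ∸ i)) ≡ sum< (suc n) F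
sum<-reverse zero    F = refl
sum<-reverse (suc n) F = begin
  F (suc n) + sum< (suc n) (λ i → F (n ∸ i)) ≡⟨ cong (_+_ (F (suc n))) (sum<-reverse n F) ⟩
  F (suc n) + sum< (suc n) F                 ≡⟨ +-comm (F (suc n)) _ ⟩
  sum< (suc n) F + F (suc n)                 ≡⟨ sum<-snoc (suc n) F ⟨
  sum< (suc (suc n)) F                       ∎
  where open ≡-Reasoning

sum<-reverse-suc : ∀ n (F : ℕ → ℕ) → sum< n (λ i → F (n ∸ i)) ≡ sum< n (λ i → F (suc i))
sum<-reverse-suc zero    F = refl
sum<-reverse-suc (suc n) F = begin
  F (suc n) + sum< n (λ i → F (n ∸ i)) ≡⟨ cong (_+_ (F (suc n))) (sum<-reverse-suc n F) ⟩
  F (suc n) + sum< n (λ i → F (suc i)) ≡⟨ +-comm (F (suc n)) _ ⟩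
  sum< n (λ i → F (suc i)) + F (suc n) ≡⟨ sum<-snoc n (λ i → F (suc i)) ⟨
  sum< (suc n) (λ i → F (suc i))       ∎
  where open ≡-Reasoning

sum<-const : ∀ n c → sum< n (λ _ → c) ≡ n * c
sum<-const zero    c = refl
sum<-const (suc n) c = cong (_+_ c) (sum<-const n c)

sum<-suc : ∀ n (F : ℕ → ℕ) → sum< n (λ i → suc (F i)) ≡ n + sum< n F
sum<-suc zero    F = refl
sum<-suc (suc n) F = cong suc (trans (cong (_+_ (F 0)) (sum<-suc n (λ i → F (suc i)))) (x+[y+z]≡y+[x+z] (F 0) n _))
  where
  x+[y+z]≡y+[x+z] : ∀ x y z → x + (y + z) ≡ y + (x + z)
  x+[y+z]≡y+[x+z] = solve-∀

sumFin-cong : ∀ n {f g : Fin n → ℕ} → (∀ i → f i ≡ g i) → sumFin n f ≡ sumFin n g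
sumFin-cong zero    f≡g = refl
sumFin-cong (suc n) f≡g = cong₂ _+_ (f≡g fzero) (sumFin-cong n (λ i → f≡g (fsuc i)))

sumFin-+ : ∀ n (f g : Fin n → ℕ) → sumFin n (λ i → f i + g i) ≡ sumFin n f + sumFin n g
sumFin-+ zero    f g = refl
sumFin-+ (suc n) f g = trans (cong (_+_ (f fzero + g fzero)) (sumFin-+ n _ _)) (+-interchange (f fzero) (g fzero) _ _)
  where
  +-interchange : ∀ a b c d → a + b + (c + d) ≡ a + c + (b + d)
  +-interchange = solve-∀

sumFin-zero : ∀ n → sumFin n (λ _ → 0) ≡ 0
sumFin-zero zero    = refl
sumFin-zero (suc n) = sumFin-zero n

sumFin-const : ∀ n c → sumFin n (λ _ → c) ≡ n * c
sumFin-const zero    c = refl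
sumFin-const (suc n) c = cong (_+_ c) (sumFin-const n c)

sumFin-swap : ∀ a b (f : Fin a → Fin b → ℕ) →
  sumFin a (λ x → sumFin b (f x)) ≡ sumFin b (λ y → sumFin a (λ x → f x y))
sumFin-swap zero    b f = sym (sumFin-zero b)
sumFin-swap (suc a) b f = trans (cong (_+_ (sumFin b (f fzero))) (sumFin-swap a b (λ x → f (fsuc x))))
  (sym (sumFin-+ b (f fzero) (λ y → sumFin a (λ x → f (fsuc x) y))))

upper : ∀ {n} → (Fin n → Fin n → ℕ) → Fin n → Fin n → ℕ
upper f x y = if toℕ x <ᵇ toℕ y then f x y else 0

≡upper+upper-flip : ∀ {n} (f : Fin n → Fin n → ℕ) → (∀ x → f x x ≡ 0) →
  ∀ x y → f x y ≡ upper f x y + upper (λ a b → f b a) y x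
≡upper+upper-flip f f-diag x y with toℕ x <ᵇ toℕ y in x<ᵇy | toℕ y <ᵇ toℕ x in y<ᵇx
... | true  | true  =
  ⊥-elim (<-asym (<ᵇ⇒< (toℕ x) (toℕ y) (subst T (sym x<ᵇy) tt)) (<ᵇ⇒< (toℕ y) (toℕ x) (subst T (sym y<ᵇx) tt)))
... | true  | false = sym (+-identityʳ _)
... | false | true  = refl
... | false | false = trans (cong (f x) (sym x≡y)) (f-diag x)
  where
  x≡y : x ≡ y
  x≡y with <-cmp (toℕ x) (toℕ y)
  ... | tri< x<y _ _ = ⊥-elim (subst T x<ᵇy (<⇒<ᵇ x<y))
  ... | tri≈ _ x≡y _ = toℕ-injective x≡y
  ... | tri> _ _ y<x = ⊥-elim (subst T y<ᵇx (<⇒<ᵇ y<x))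

2*sum-upper≡sum : ∀ n (f : Fin n → Fin n → ℕ) → (∀ x y → f x y ≡ f y x) → (∀ x → f x x ≡ 0) →
  2 * sumFin n (λ x → sumFin n (upper f x)) ≡ sumFin n (λ x → sumFin n (f x))
2*sum-upper≡sum n f f-sym f-diag = sym (begin
  sumFin n (λ x → sumFin n (f x))
    ≡⟨ sumFin-cong n (λ x → sumFin-cong n (≡upper+upper-flip f f-diag x)) ⟩
  sumFin n (λ x → sumFin n (λ y → upper f x y + upper f′ y x))
    ≡⟨ sumFin-cong n (λ x → sumFin-+ n _ _) ⟩
  sumFin n (λ x → sumFin n (upper f x) + sumFin n (λ y → upper f′ y x))
    ≡⟨ sumFin-+ n _ _ ⟩
  U + sumFin n (λ x → sumFin n (λ y → upper f′ y x))
    ≡⟨ cong (_+_ U) (sumFin-swap n n (λ x y → upper f′ y x)) ⟩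
  U + sumFin n (λ y → sumFin n (upper f′ y))
    ≡⟨ cong (_+_ U) (sumFin-cong n (λ y → sumFin-cong n (λ x → cong (λ z → if toℕ y <ᵇ toℕ x then z else 0) (f-sym x y)))) ⟩
  U + U
    ≡⟨ cong (_+_ U) (+-identityʳ U) ⟨
  2 * U ∎)
  where
  open ≡-Reasoning
  f′ : Fin n → Fin n → ℕ
  f′ a b = f b a
  U = sumFin n (λ x → sumFin n (upper f x))

cyc∣x-i∣≡cyc[t+i] : ∀ x t i → i < x → cyc (x + t) ∣ x - i ∣ ≡ cyc (x + t) (t + i)
cyc∣x-i∣≡cyc[t+i] x t i i<x with m≤n⇒∃[o]m+o≡n (<⇒≤ i<x)
... | u , refl = begin
  cyc N ∣ i + u - i ∣      ≡⟨ cong (cyc N) (∣m+n-m∣≡n i u) ⟩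
  u ⊓ (N ∸ u)              ≡⟨ cong (u ⊓_) (m≡n+o⇒m∸n≡o u (rearrange₁ i u t)) ⟩
  u ⊓ (i + t)              ≡⟨ ⊓-comm u (i + t) ⟩
  (i + t) ⊓ u              ≡⟨ cong₂ _⊓_ (+-comm t i) (m≡n+o⇒m∸n≡o (t + i) (rearrange₂ i u t)) ⟨
  (t + i) ⊓ (N ∸ (t + i))  ∎
  where
  open ≡-Reasoning
  N = i + u + t
  rearrange₁ : ∀ i u t → i + u + t ≡ u + (i + t)
  rearrange₁ = solve-∀
  rearrange₂ : ∀ i u t → i + u + t ≡ t + i + u
  rearrange₂ = solve-∀

sum<-circ-rotate : ∀ N x (F : ℕ → ℕ) → x < N → sum< N (λ y → F (circ N x y)) ≡ sum< N (λ s → F (cyc N s))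
sum<-circ-rotate N x F x<N with m≤n⇒∃[o]m+o≡n (<⇒≤ x<N)
... | t , refl = begin
  sum< (x + t) G                                ≡⟨ sum<-+ x t G ⟩
  sum< x G + sum< t (λ i → G (x + i))
    ≡⟨ cong₂ _+_ (sum<-cong x (λ i i<x → cong F (cyc∣x-i∣≡cyc[t+i] x t i i<x)))
                 (sum<-cong t (λ i _ → cong (λ z → F (cyc (x + t) z)) (∣m-m+n∣≡n x i))) ⟩
  sum< x (λ i → H (t + i)) + sum< t H           ≡⟨ +-comm _ (sum< t H) ⟩
  sum< t H + sum< x (λ i → H (t + i))           ≡⟨ sum<-+ t x H ⟨
  sum< (t + x) H                                ≡⟨ cong (λ z → sum< z H) (+-comm t x) ⟩
  sum< (x + t) H                                ∎
  where
  open ≡-Reasoning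
  G : ℕ → ℕ
  G y = F (circ (x + t) x y)
  H : ℕ → ℕ
  H s = F (cyc (x + t) s)

sum<-cyc-fold : ∀ m (F : ℕ → ℕ) → sum< (m + m) (λ s → F (cyc (m + m) s)) ≡ sum< m F + sum< m (λ i → F (suc i))
sum<-cyc-fold m F = trans (sum<-+ m m _) (cong₂ _+_
  (sum<-cong m (λ i i<m → cong F (cyc-below-half m i (<⇒≤ i<m))))
  (trans (sum<-cong m (λ t _ → cong F (cyc[m+d]≡m∸d m t))) (sum<-reverse-suc m F)))

-- Arithmetic of the parameters

[m+m]/2≡m : ∀ m → (m + m) / 2 ≡ m
[m+m]/2≡m m = trans (cong (_/ 2) (m+m≡m*2 m)) (m*n/n≡m m 2)
  where
  m+m≡m*2 : ∀ m → m + m ≡ m * 2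
  m+m≡m*2 = solve-∀

[m+n*o]/o≡n : ∀ m n o .{{_ : NonZero o}} → m < o → (m + n * o) / o ≡ n
[m+n*o]/o≡n m n o m<o = trans (+-distrib-/ m (n * o) %-sum<o) (cong₂ _+_ (m<n⇒m/n≡0 m<o) (m*n/n≡m n o))
  where
  %-sum<o : m % o + (n * o) % o < o
  %-sum<o = subst (_< o) (sym (cong₂ _+_ (m<n⇒m%n≡m m<o) (m*n%n≡0 n o))) (subst (_< o) (sym (+-identityʳ m)) m<o)

odd≥3-form : ∀ k → 3 ≤ k → ¬ (2 ∣ k) → ∃[ r′ ] k ≡ suc (suc r′ + suc r′)
odd≥3-form k 3≤k k-odd with k % 2 in k%2≡ | m%n<n k 2
... | zero        | _               = ⊥-elim (k-odd (m%n≡0⇒n∣m k 2 k%2≡))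
... | suc (suc _) | s≤s (s≤s ())
... | suc zero    | _ with k / 2 in k/2≡
...   | zero   =
  ⊥-elim (<⇒≱ 3≤k (≤-trans (≤-reflexive (trans (m≡m%n+[m/n]*n k 2) (cong₂ (λ a b → a + b * 2) k%2≡ k/2≡))) (n≤1+n 1)))
...   | suc r′ = r′ , trans (m≡m%n+[m/n]*n k 2) (trans (cong₂ (λ a b → a + b * 2) k%2≡ k/2≡) (1+[1+r′]*2 r′))
  where
  1+[1+r′]*2 : ∀ r′ → 1 + suc r′ * 2 ≡ suc (suc r′ + suc r′)
  1+[1+r′]*2 = solve-∀

even>0-form : ∀ n → 0 < n → 2 ∣ n → ∃[ m₀ ] n ≡ suc m₀ + suc m₀
even>0-form n 0<n (divides zero    n≡0) = ⊥-elim (<-irrefl (sym n≡0) 0<n)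
even>0-form n 0<n (divides (suc m₀) n≡) = m₀ , trans n≡ (*2≡+ (suc m₀))
  where
  *2≡+ : ∀ m → m * 2 ≡ m + m
  *2≡+ = solve-∀

StatusFormula : (n k D S : ℕ) → Set
StatusFormula n k D S = + 2 *ℤ + S ≡ + D *ℤ (+ (2 * n + 4 * k) -ℤ + 8 -ℤ + (2 * (k ∸ 1) * D)) -ℤ + 2 *ℤ (+ k -ℤ + 2)

WienerFormula : (n k D W : ℕ) → Set
WienerFormula n k D W =
  + 4 *ℤ + W ≡ + n *ℤ + D *ℤ (+ (2 * n + 4 * k) -ℤ + 8 -ℤ + (2 * (k ∸ 1) * D)) -ℤ + 2 *ℤ + n *ℤ (+ k -ℤ + 2)

-- The identity of StatusFormula with all subtractions moved across, so that it lives in ℕ.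
ℕ-StatusFormula : ∀ n k D S b → 2 * S + 8 * D + b * D + 2 * k ≡ D * (2 * n + 4 * k) + 4 →
  + 2 *ℤ + S ≡ + D *ℤ (+ (2 * n + 4 * k) -ℤ + 8 -ℤ + b) -ℤ + 2 *ℤ (+ k -ℤ + 2)
ℕ-StatusFormula n k D S b h = begin
  + 2 *ℤ + S                                    ≡⟨ isolate (+ S) (+ D) (+ b) (+ k) ⟩
  (+ 2 *ℤ + S +ℤ + 8 *ℤ + D +ℤ + b *ℤ + D +ℤ + 2 *ℤ + k) -ℤ R
                                                ≡⟨ cong (_-ℤ R) ℤ-h ⟩
  (+ D *ℤ + a +ℤ + 4) -ℤ R                      ≡⟨ regroup (+ D) (+ a) (+ b) (+ k) ⟩
  + D *ℤ (+ a -ℤ + 8 -ℤ + b) -ℤ + 2 *ℤ (+ k -ℤ + 2) ∎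
  where
  open ≡-Reasoning
  a = 2 * n + 4 * k
  R = + 8 *ℤ + D +ℤ + b *ℤ + D +ℤ + 2 *ℤ + k
  isolate : ∀ s d b k → + 2 *ℤ s ≡ (+ 2 *ℤ s +ℤ + 8 *ℤ d +ℤ b *ℤ d +ℤ + 2 *ℤ k) -ℤ (+ 8 *ℤ d +ℤ b *ℤ d +ℤ + 2 *ℤ k)
  isolate = ℤ-Solver.solve-∀
  regroup : ∀ d a b k → (d *ℤ a +ℤ + 4) -ℤ (+ 8 *ℤ d +ℤ b *ℤ d +ℤ + 2 *ℤ k) ≡ d *ℤ (a -ℤ + 8 -ℤ b) -ℤ + 2 *ℤ (k -ℤ + 2)
  regroup = ℤ-Solver.solve-∀
  ℤ-h : + 2 *ℤ + S +ℤ + 8 *ℤ + D +ℤ + b *ℤ + D +ℤ + 2 *ℤ + k ≡ + D *ℤ + a +ℤ + 4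
  ℤ-h = begin
    + 2 *ℤ + S +ℤ + 8 *ℤ + D +ℤ + b *ℤ + D +ℤ + 2 *ℤ + k
      ≡⟨ cong₂ _+ℤ_ (cong₂ _+ℤ_ (cong₂ _+ℤ_ (ℤ.pos-* 2 S) (ℤ.pos-* 8 D)) (ℤ.pos-* b D)) (ℤ.pos-* 2 k) ⟨
    + (2 * S) +ℤ + (8 * D) +ℤ + (b * D) +ℤ + (2 * k)
      ≡⟨ cong (λ z → z +ℤ + (b * D) +ℤ + (2 * k)) (ℤ.pos-+ (2 * S) (8 * D)) ⟨
    + (2 * S + 8 * D) +ℤ + (b * D) +ℤ + (2 * k)
      ≡⟨ cong (_+ℤ + (2 * k)) (ℤ.pos-+ (2 * S + 8 * D) (b * D)) ⟨
    + (2 * S + 8 * D + b * D) +ℤ + (2 * k)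
      ≡⟨ ℤ.pos-+ (2 * S + 8 * D + b * D) (2 * k) ⟨
    + (2 * S + 8 * D + b * D + 2 * k)
      ≡⟨ cong +_ h ⟩
    + (D * a + 4)
      ≡⟨ ℤ.pos-+ (D * a) 4 ⟩
    + (D * a) +ℤ + 4
      ≡⟨ cong (_+ℤ + 4) (ℤ.pos-* D a) ⟩
    + D *ℤ + a +ℤ + 4 ∎

status-formula : ∀ r m q S → S + 2 * r * (suc q * suc q) + 2 * suc (suc q) ≡ 2 * m * suc (suc q) + 1 →
  StatusFormula (m + m) (suc (r + r)) (suc (suc q)) S
status-formula r m q S h = ℕ-StatusFormula (m + m) (suc (r + r)) D S (2 * (r + r) * D) (+-cancelʳ-≡ X _ _ (begin
  2 * S + 8 * D + 2 * (r + r) * D * D + 2 * suc (r + r) + X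
    ≡⟨ expand S r q ⟩
  2 * (S + 2 * r * (suc q * suc q) + 2 * D) + Y
    ≡⟨ cong (λ z → 2 * z + Y) h ⟩
  2 * (2 * m * D + 1) + Y
    ≡⟨ collect r m q ⟩
  D * (2 * (m + m) + 4 * suc (r + r)) + 4 + X ∎))
  where
  open ≡-Reasoning
  D = suc (suc q)
  X = 2 * (2 * r * (suc q * suc q) + 2 * D)
  Y = 8 * D + 2 * (r + r) * D * D + 2 * suc (r + r)
  expand : ∀ S r q → 2 * S + 8 * suc (suc q) + 2 * (r + r) * suc (suc q) * suc (suc q) + 2 * suc (r + r)
                     + 2 * (2 * r * (suc q * suc q) + 2 * suc (suc q))
                   ≡ 2 * (S + 2 * r * (suc q * suc q) + 2 * suc (suc q))
                     + (8 * suc (suc q) + 2 * (r + r) * suc (suc q) * suc (suc q) + 2 * suc (r + r))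
  expand = solve-∀
  collect : ∀ r m q → 2 * (2 * m * suc (suc q) + 1)
                      + (8 * suc (suc q) + 2 * (r + r) * suc (suc q) * suc (suc q) + 2 * suc (r + r))
                    ≡ suc (suc q) * (2 * (m + m) + 4 * suc (r + r)) + 4
                      + 2 * (2 * r * (suc q * suc q) + 2 * suc (suc q))
  collect = solve-∀

status-for-D≡2 : ∀ r m S → S + 2 * r * (1 * 1) + 2 * 2 ≡ 2 * m * 2 + 1 → S ≡ 2 * (m + m) ∸ suc (r + r) ∸ 2
status-for-D≡2 r m S h = sym (trans (∸-+-assoc (2 * (m + m)) (suc (r + r)) 2) (m≡n+o⇒m∸n≡o (suc (r + r) + 2) 4m≡k+2+S))
  where
  lhs : ∀ m → 2 * (m + m) + 1 ≡ 2 * m * 2 + 1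
  lhs = solve-∀
  rhs : ∀ S r → S + 2 * r * (1 * 1) + 2 * 2 ≡ suc (r + r) + 2 + S + 1
  rhs = solve-∀
  4m≡k+2+S : 2 * (m + m) ≡ suc (r + r) + 2 + S
  4m≡k+2+S = +-cancelʳ-≡ 1 _ _ (trans (lhs m) (trans (sym h) (rhs S r)))

wiener-formula : ∀ n k D S W → 2 * W ≡ n * S → StatusFormula n k D S → WienerFormula n k D W
wiener-formula n k D S W 2W≡nS status≡ = begin
  + 4 *ℤ + W                         ≡⟨ four≡two*two (+ W) ⟩
  + 2 *ℤ (+ 2 *ℤ + W)                ≡⟨ cong (+ 2 *ℤ_) (trans (sym (ℤ.pos-* 2 W)) (trans (cong +_ 2W≡nS) (ℤ.pos-* n S))) ⟩
  + 2 *ℤ (+ n *ℤ + S)                ≡⟨ *ℤ-swap (+ n) (+ S) ⟩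
  + n *ℤ (+ 2 *ℤ + S)                ≡⟨ cong (+ n *ℤ_) status≡ ⟩
  + n *ℤ (+ D *ℤ X -ℤ + 2 *ℤ Y)      ≡⟨ distribute (+ n) (+ D) X Y ⟩
  + n *ℤ + D *ℤ X -ℤ + 2 *ℤ + n *ℤ Y ∎
  where
  open ≡-Reasoning
  X = + (2 * n + 4 * k) -ℤ + 8 -ℤ + (2 * (k ∸ 1) * D)
  Y = + k -ℤ + 2
  four≡two*two : ∀ w → + 4 *ℤ w ≡ + 2 *ℤ (+ 2 *ℤ w)
  four≡two*two = ℤ-Solver.solve-∀
  *ℤ-swap : ∀ n s → + 2 *ℤ (n *ℤ s) ≡ n *ℤ (+ 2 *ℤ s)
  *ℤ-swap = ℤ-Solver.solve-∀
  distribute : ∀ n d x y → n *ℤ (d *ℤ x -ℤ + 2 *ℤ y) ≡ n *ℤ d *ℤ x -ℤ + 2 *ℤ n *ℤ y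
  distribute = ℤ-Solver.solve-∀

-- k = 2r + 1 and n = 2m, with r and m written as successors so that both are nonzero.
module Harary (r′ m₀ : ℕ) where
  r m k N : ℕ
  r = suc r′
  m = suc m₀
  k = suc (r + r)
  N = m + m

  E : Fin N → Fin N → Set
  E = HararyAdj k N

  [k∸1]/2≡r : (k ∸ 1) / 2 ≡ r
  [k∸1]/2≡r = [m+m]/2≡m r

  N/2≡m : N / 2 ≡ m
  N/2≡m = [m+m]/2≡m m

  ⌈_/r⌉ : ℕ → ℕ
  ⌈ x /r⌉ = (x + r′) / r

  ⌈/r⌉≤ : ∀ x j → x ≤ j * r → ⌈ x /r⌉ ≤ j
  ⌈/r⌉≤ x j x≤jr = <⇒≤pred (m<n*o⇒m/o<n {x + r′} {suc j} {r} x+r′<[1+j]r)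
    where
    x+r′<[1+j]r : x + r′ < suc j * r
    x+r′<[1+j]r = subst (x + r′ <_) (+-comm (j * r) r)
      (≤-trans (s≤s (+-monoˡ-≤ r′ x≤jr)) (≤-reflexive (sym (+-suc (j * r) r′))))

  <⌈/r⌉ : ∀ x j → j * r < x → j < ⌈ x /r⌉
  <⌈/r⌉ x j jr<x = subst (_≤ ⌈ x /r⌉) (m*n/n≡m (suc j) r) (/-monoˡ-≤ r [1+j]r≤x+r′)
    where
    [1+j]r≤x+r′ : suc j * r ≤ x + r′
    [1+j]r≤x+r′ = subst (_≤ x + r′) (cong suc (+-comm (j * r) r′)) (+-monoˡ-≤ r′ jr<x)

  ⌈/r⌉≤⇒≤ : ∀ x j → ⌈ x /r⌉ ≤ j → x ≤ j * r
  ⌈/r⌉≤⇒≤ x j ⌈x⌉≤j with x ≤? j * r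
  ... | yes x≤jr = x≤jr
  ... | no x≰jr = ⊥-elim (<⇒≱ (<⌈/r⌉ x j (≰⇒> x≰jr)) ⌈x⌉≤j)

  ⌈0/r⌉≡0 : ⌈ 0 /r⌉ ≡ 0
  ⌈0/r⌉≡0 = n≤0⇒n≡0 (⌈/r⌉≤ 0 0 z≤n)

  δ : ℕ → ℕ
  δ c = ⌈ c /r⌉ ⊓ suc ⌈ m ∸ c /r⌉

  δ0≡0 : δ 0 ≡ 0
  δ0≡0 rewrite ⌈0/r⌉≡0 = refl

  δ-lipschitz : ∀ c c′ → c′ ≤ m → c ≤ r + c′ → c′ ≤ r + c → δ c ≤ suc (δ c′)
  δ-lipschitz c c′ c′≤m c≤r+c′ c′≤r+c = ⊓-mono-≤ along across
    where
    along : ⌈ c /r⌉ ≤ suc ⌈ c′ /r⌉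
    along = ⌈/r⌉≤ c (suc ⌈ c′ /r⌉) (≤-trans c≤r+c′ (+-monoʳ-≤ r (⌈/r⌉≤⇒≤ c′ ⌈ c′ /r⌉ ≤-refl)))
    m≤c+[r+[m∸c′]] : m ≤ c + (r + (m ∸ c′))
    m≤c+[r+[m∸c′]] = begin
      m                  ≡⟨ m+[n∸m]≡n c′≤m ⟨
      c′ + (m ∸ c′)      ≤⟨ +-monoˡ-≤ (m ∸ c′) c′≤r+c ⟩
      r + c + (m ∸ c′)   ≡⟨ rearrange r c (m ∸ c′) ⟩
      c + (r + (m ∸ c′)) ∎
      where
      open ≤-Reasoning
      rearrange : ∀ a b c → a + b + c ≡ b + (a + c)
      rearrange = solve-∀
    across : suc ⌈ m ∸ c /r⌉ ≤ suc (suc ⌈ m ∸ c′ /r⌉)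
    across = s≤s (⌈/r⌉≤ (m ∸ c) (suc ⌈ m ∸ c′ /r⌉)
      (≤-trans (m≤n+o⇒m∸n≤o m c m≤c+[r+[m∸c′]]) (+-monoʳ-≤ r (⌈/r⌉≤⇒≤ (m ∸ c′) _ ≤-refl))))

  δ-antipode : ∀ c → c ≤ m → δ c ≤ suc (δ (m ∸ c))
  δ-antipode c c≤m rewrite m∸[m∸n]≡n c≤m =
    ⊓-glb (m⊓n≤n ⌈ c /r⌉ _) (≤-trans (m⊓n≤m ⌈ c /r⌉ _) (≤-trans (n≤1+n _) (n≤1+n _)))

  <⌈/r⌉-+r : ∀ c c′ → c′ + r ≤ c → ⌈ c′ /r⌉ < ⌈ c /r⌉
  <⌈/r⌉-+r c c′ c′+r≤c = <⌈/r⌉ c ⌈ c′ /r⌉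
    (≤-trans (s≤s (m/n*n≤m (c′ + r′) r)) (≤-trans (≤-reflexive (sym (+-suc c′ r′))) c′+r≤c))

  0<δ⇒0< : ∀ c → 0 < δ c → 0 < c
  0<δ⇒0< zero    0<δ0 = ⊥-elim (<-irrefl (sym δ0≡0) 0<δ0)
  0<δ⇒0< (suc c) _    = z<s

  δ≡0⇒≡0 : ∀ c → δ c ≡ 0 → c ≡ 0
  δ≡0⇒≡0 zero    _    = refl
  δ≡0⇒≡0 (suc c) δ≡0 = ⊥-elim (<-irrefl (sym δ≡0) (⊓-glb (<⌈/r⌉ (suc c) 0 z<s) z<s))

  dist : Fin N → Fin N → ℕ
  dist x y = δ (circ N (toℕ x) (toℕ y))

  dist-self : ∀ z → dist z z ≡ 0
  dist-self z = trans (cong (λ u → δ (cyc N u)) (∣n-n∣≡0 (toℕ z))) δ0≡0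

  dist-sym : ∀ x y → dist x y ≡ dist y x
  dist-sym x y = cong δ (circ-comm N (toℕ x) (toℕ y))

  circ-antipodal : ∀ (v w z : Fin N) → toℕ w ≡ (toℕ v + N / 2) % N → circ N (toℕ w) (toℕ z) ≡ m ∸ circ N (toℕ v) (toℕ z)
  circ-antipodal v w z w≡v+N/2 = begin
    circ N (toℕ w) (toℕ z)               ≡⟨ cong (λ u → circ N u (toℕ z)) w≡v+N/2 ⟩
    circ N ((toℕ v + N / 2) % N) (toℕ z) ≡⟨ cong (λ h → circ N ((toℕ v + h) % N) (toℕ z)) N/2≡m ⟩
    circ N ((toℕ v + m) % N) (toℕ z)     ≡⟨ circ-antipode m (toℕ v) (toℕ z) (toℕ<n v) (toℕ<n z) ⟩
    m ∸ circ N (toℕ v) (toℕ z)           ∎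
    where open ≡-Reasoning

  dist-adjacent : ∀ z v w → E v w → dist v z ≤ suc (dist w z)
  dist-adjacent z v w (inj₁ (_ , v-w≤[k∸1]/2)) =
    δ-lipschitz cv cw (circ≤half m (toℕ w) (toℕ z)) cv≤r+cw cw≤r+cv
    where
    cv = circ N (toℕ v) (toℕ z)
    cw = circ N (toℕ w) (toℕ z)
    v-w≤r : circ N (toℕ v) (toℕ w) ≤ r
    v-w≤r = subst (circ N (toℕ v) (toℕ w) ≤_) [k∸1]/2≡r v-w≤[k∸1]/2
    cv≤r+cw : cv ≤ r + cw
    cv≤r+cw = ≤-trans (circ-triangle N (toℕ v) (toℕ w) (toℕ z) (toℕ<n v) (toℕ<n w) (toℕ<n z)) (+-monoˡ-≤ cw v-w≤r)
    cw≤r+cv : cw ≤ r + cv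
    cw≤r+cv = ≤-trans (circ-triangle N (toℕ w) (toℕ v) (toℕ z) (toℕ<n w) (toℕ<n v) (toℕ<n z))
      (+-monoˡ-≤ cv (subst (_≤ r) (circ-comm N (toℕ v) (toℕ w)) v-w≤r))
  dist-adjacent z v w (inj₂ w-antipodal) =
    subst (λ u → dist v z ≤ suc (δ u)) (sym (circ-antipodal v w z w-antipodal))
      (δ-antipode (circ N (toℕ v) (toℕ z)) (circ≤half m (toℕ v) (toℕ z)))

  dist≤length : ∀ z v l → Walk E v z l → dist v z ≤ l
  dist≤length z .z .0       nil                        = ≤-reflexive (dist-self z)
  dist≤length z v  .(suc l) (cons {y = w} {l = l} e p) = ≤-trans (dist-adjacent z v w e) (s≤s (dist≤length z w l p))

  antipode : Fin N → Fin N
  antipode v = fromℕ< (m%n<n (toℕ v + N / 2) N)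

  adjacent-antipode : ∀ v → E v (antipode v)
  adjacent-antipode v = inj₂ (toℕ-fromℕ< _)

  CloserNeighbour : Fin N → Fin N → Set
  CloserNeighbour v z = ∃[ w ] E v w × suc (dist w z) ≤ dist v z

  closer-across : ∀ v z → let c = circ N (toℕ v) (toℕ z) in
    suc ⌈ m ∸ c /r⌉ < ⌈ c /r⌉ → CloserNeighbour v z
  closer-across v z across<along = antipode v , adjacent-antipode v , (begin
    suc (δ (circ N (toℕ (antipode v)) (toℕ z))) ≡⟨ cong (λ u → suc (δ u)) (circ-antipodal v (antipode v) z (toℕ-fromℕ< _)) ⟩
    suc (δ (m ∸ c))                            ≤⟨ s≤s (m⊓n≤m _ _) ⟩
    suc ⌈ m ∸ c /r⌉                            ≡⟨ m≥n⇒m⊓n≡n (<⇒≤ across<along) ⟨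
    δ c                                        ∎)
    where
    open ≤-Reasoning
    c = circ N (toℕ v) (toℕ z)

  closer-direct : ∀ v z → 0 < dist v z → circ N (toℕ v) (toℕ z) ≤ r → CloserNeighbour v z
  closer-direct v z 0<dist c≤r =
    z , inj₁ (0<δ⇒0< c 0<dist , subst (c ≤_) (sym [k∸1]/2≡r) c≤r) , subst (_≤ dist v z) (cong suc (sym (dist-self z))) 0<dist
    where
    c = circ N (toℕ v) (toℕ z)

  closer-along : ∀ v z → let c = circ N (toℕ v) (toℕ z) in
    ⌈ c /r⌉ ≤ suc ⌈ m ∸ c /r⌉ → r < c → CloserNeighbour v z
  closer-along v z along≤across r<c with step-toward m r (toℕ v) (toℕ z) (toℕ<n v) (toℕ<n z) r<c
  ... | w , w<N , v-w≡r , w-z+r≤c =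
    fromℕ< w<N , inj₁ (subst (0 <_) (sym v-w′≡r) z<s , ≤-reflexive (trans v-w′≡r (sym [k∸1]/2≡r))) , (begin
    suc (δ (circ N (toℕ (fromℕ< w<N)) (toℕ z))) ≡⟨ cong (λ u → suc (δ (circ N u (toℕ z)))) (toℕ-fromℕ< w<N) ⟩
    suc (δ (circ N w (toℕ z)))                  ≤⟨ s≤s (m⊓n≤m _ _) ⟩
    suc ⌈ circ N w (toℕ z) /r⌉                  ≤⟨ <⌈/r⌉-+r c (circ N w (toℕ z)) w-z+r≤c ⟩
    ⌈ c /r⌉                                     ≡⟨ m≤n⇒m⊓n≡m along≤across ⟨
    δ c                                         ∎)
    where
    open ≤-Reasoning
    c = circ N (toℕ v) (toℕ z)
    v-w′≡r : circ N (toℕ v) (toℕ (fromℕ< w<N)) ≡ r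
    v-w′≡r = trans (cong (circ N (toℕ v)) (toℕ-fromℕ< w<N)) v-w≡r

  closer-neighbour : ∀ v z → 0 < dist v z → CloserNeighbour v z
  closer-neighbour v z 0<dist with ⌈ circ N (toℕ v) (toℕ z) /r⌉ ≤? suc ⌈ m ∸ circ N (toℕ v) (toℕ z) /r⌉
  ... | no along≰across = closer-across v z (≰⇒> along≰across)
  ... | yes along≤across with circ N (toℕ v) (toℕ z) ≤? r
  ...   | yes c≤r = closer-direct v z 0<dist c≤r
  ...   | no c≰r  = closer-along v z along≤across (≰⇒> c≰r)

  walk-of-length-dist : ∀ z d v → dist v z ≡ d → Walk E v z d
  walk-of-length-dist z zero v dist≡0 = subst (λ u → Walk E u z 0) (sym v≡z) nil
    where
    v≡z : v ≡ z
    v≡z = toℕ-injective (circ≡0⇒≡ N (toℕ v) (toℕ z) (toℕ<n v) (toℕ<n z) (δ≡0⇒≡0 _ dist≡0))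
  walk-of-length-dist z (suc d) v dist≡1+d with closer-neighbour v z (subst (0 <_) (sym dist≡1+d) z<s)
  ... | w , v~w , closer = cons v~w (walk-of-length-dist z d w (≤-antisym
    (s≤s⁻¹ (subst (suc (dist w z) ≤_) dist≡1+d closer))
    (s≤s⁻¹ (subst (_≤ suc (dist w z)) dist≡1+d (dist-adjacent z v w v~w)))))

  dist-isDist : ∀ x y → IsDist E x y (dist x y)
  dist-isDist x y = walk-of-length-dist y (dist x y) x refl , dist≤length y x

  2*sum⌈/r⌉ : ∀ j → 2 * sum< (j * r + 1) ⌈_/r⌉ ≡ r * j * suc j
  2*sum⌈/r⌉ zero rewrite ⌈0/r⌉≡0 = sym (r*0*1≡0 r)
    where
    r*0*1≡0 : ∀ r → r * 0 * 1 ≡ 0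
    r*0*1≡0 = solve-∀
  2*sum⌈/r⌉ (suc j) = begin
    2 * sum< (suc j * r + 1) ⌈_/r⌉
      ≡⟨ cong (λ x → 2 * sum< x ⌈_/r⌉) (split-range j r) ⟩
    2 * sum< (j * r + 1 + r) ⌈_/r⌉
      ≡⟨ cong (2 *_) (sum<-+ (j * r + 1) r ⌈_/r⌉) ⟩
    2 * (sum< (j * r + 1) ⌈_/r⌉ + sum< r (λ i → ⌈ j * r + 1 + i /r⌉))
      ≡⟨ cong (λ x → 2 * (sum< (j * r + 1) ⌈_/r⌉ + x)) (trans (sum<-cong r ⌈/r⌉-on-block) (sum<-const r (suc j))) ⟩
    2 * (sum< (j * r + 1) ⌈_/r⌉ + r * suc j)
      ≡⟨ *-distribˡ-+ 2 (sum< (j * r + 1) ⌈_/r⌉) (r * suc j) ⟩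
    2 * sum< (j * r + 1) ⌈_/r⌉ + 2 * (r * suc j)
      ≡⟨ cong (_+ 2 * (r * suc j)) (2*sum⌈/r⌉ j) ⟩
    r * j * suc j + 2 * (r * suc j)
      ≡⟨ close-form r j ⟩
    r * suc j * suc (suc j) ∎
    where
    open ≡-Reasoning
    split-range : ∀ j r → suc j * r + 1 ≡ j * r + 1 + r
    split-range = solve-∀
    close-form : ∀ r j → r * j * suc j + 2 * (r * suc j) ≡ r * suc j * suc (suc j)
    close-form = solve-∀
    ⌈/r⌉-on-block : ∀ i → i < r → ⌈ j * r + 1 + i /r⌉ ≡ suc j
    ⌈/r⌉-on-block i i<r = ≤-antisym
      (⌈/r⌉≤ _ (suc j) (subst (_≤ suc j * r) (sym (+-assoc (j * r) 1 i))
        (subst (j * r + suc i ≤_) (+-comm (j * r) r) (+-monoʳ-≤ (j * r) i<r))))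
      (<⌈/r⌉ _ j (≤-trans (≤-reflexive (+-comm 1 (j * r))) (m≤m+n (j * r + 1) i)))

  S : ℕ
  S = sum< m δ + sum< m (λ i → δ (suc i))

  sumFin-dist≡S : ∀ x → sumFin N (dist x) ≡ S
  sumFin-dist≡S x = trans (sumFin-toℕ N (λ s → δ (circ N (toℕ x) s)))
    (trans (sum<-circ-rotate N (toℕ x) δ (toℕ<n x)) (sum<-cyc-fold m δ))

  status : ∀ x → IsStatus E x S
  status x = dist x , dist-isDist x , sym (sumFin-dist≡S x)

  W : ℕ
  W = sumFin N (λ x → sumFin N (upper dist x))

  wiener : IsWiener E W
  wiener = dist , dist-isDist , refl

  2W≡NS : 2 * W ≡ N * S
  2W≡NS = trans (2*sum-upper≡sum N dist dist-sym dist-self) (trans (sumFin-cong N sumFin-dist≡S) (sumFin-const N S))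

  δm≡1 : δ m ≡ 1
  δm≡1 = ⊓≡ (<⌈/r⌉ m 0 z<s) z<s (inj₂ (s≤s (≤-reflexive (trans (cong ⌈_/r⌉ (n∸n≡0 m)) ⌈0/r⌉≡0))))

  S+1≡2*sum≤m : S + 1 ≡ 2 * sum< (suc m) δ
  S+1≡2*sum≤m = begin
    sum< m δ + sum< m (λ i → δ (suc i)) + 1   ≡⟨ +-right-comm (sum< m δ) _ 1 ⟩
    (sum< m δ + 1) + sum< m (λ i → δ (suc i)) ≡⟨ cong₂ _+_ (trans (cong (_+_ (sum< m δ)) (sym δm≡1)) (sym (sum<-snoc m δ)))
                                                            (cong (_+ sum< m (λ i → δ (suc i))) (sym δ0≡0)) ⟩
    sum< (suc m) δ + sum< (suc m) δ           ≡⟨ cong (_+_ (sum< (suc m) δ)) (+-identityʳ _) ⟨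
    2 * sum< (suc m) δ                        ∎
    where
    open ≡-Reasoning
    +-right-comm : ∀ a b c → a + b + c ≡ a + c + b
    +-right-comm = solve-∀

  module ClosedForm (q e : ℕ) (m≡A+[1+e]+qr : m ≡ suc (suc q * r) + suc e + q * r) (e<r+r : e < r + r) where
    A B D : ℕ
    A = suc (suc q * r)
    B = A + suc e
    D = suc (suc q)

    q<⌈m∸x/r⌉ : ∀ x → x + q * r < m → q < ⌈ m ∸ x /r⌉
    q<⌈m∸x/r⌉ x x+qr<m = <⌈/r⌉ (m ∸ x) q
      (subst (_≤ m ∸ x) (m+n∸m≡n x (suc (q * r))) (∸-monoˡ-≤ x (subst (_≤ m) (sym (+-suc x (q * r))) x+qr<m)))

    δ-rising : ∀ i → i < A → δ i ≡ ⌈ i /r⌉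
    δ-rising i i<A = m≤n⇒m⊓n≡m (≤-trans (⌈/r⌉≤ i (suc q) (s≤s⁻¹ i<A)) (≤-trans (q<⌈m∸x/r⌉ i i+qr<m) (n≤1+n _)))
      where
      i+qr<m : i + q * r < m
      i+qr<m = ≤-trans (+-monoˡ-≤ (q * r) i<A)
        (≤-trans (+-monoˡ-≤ (q * r) (m≤m+n A (suc e))) (≤-reflexive (sym m≡A+[1+e]+qr)))

    δ-plateau : ∀ t → t < suc e → δ (A + t) ≡ D
    δ-plateau t t≤e = ⊓≡ (<⌈/r⌉ (A + t) (suc q) (m≤m+n A t)) (s≤s (q<⌈m∸x/r⌉ (A + t) A+t+qr<m)) attained
      where
      A+t+qr<m : A + t + q * r < m
      A+t+qr<m = ≤-trans (+-monoˡ-< (q * r) (+-monoʳ-< A t≤e)) (≤-reflexive (sym m≡A+[1+e]+qr))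
      attained : ⌈ A + t /r⌉ ≤ D ⊎ suc ⌈ m ∸ (A + t) /r⌉ ≤ D
      attained with t <? r
      ... | yes t<r = inj₁ (⌈/r⌉≤ (A + t) D (begin
        A + t             ≡⟨ +-suc (suc q * r) t ⟨
        suc q * r + suc t ≤⟨ +-monoʳ-≤ (suc q * r) t<r ⟩
        suc q * r + r     ≡⟨ +-comm (suc q * r) r ⟩
        D * r             ∎))
        where open ≤-Reasoning
      ... | no t≮r = inj₂ (s≤s (⌈/r⌉≤ (m ∸ (A + t)) (suc q) (m≤n+o⇒m∸n≤o m (A + t) (begin
        m                    ≡⟨ m≡A+[1+e]+qr ⟩
        A + suc e + q * r    ≤⟨ +-monoˡ-≤ (q * r) (+-monoʳ-≤ A (≤-trans e<r+r (+-monoʳ-≤ r (≮⇒≥ t≮r)))) ⟩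
        A + (r + t) + q * r  ≡⟨ rearrange A r t (q * r) ⟩
        A + t + suc q * r    ∎))))
        where
        open ≤-Reasoning
        rearrange : ∀ a b c d → a + (b + c) + d ≡ a + c + (b + d)
        rearrange = solve-∀

    δ-falling : ∀ t → t < suc (q * r) → δ (B + t) ≡ suc ⌈ q * r ∸ t /r⌉
    δ-falling t t≤qr = trans (cong (λ x → ⌈ B + t /r⌉ ⊓ suc ⌈ x /r⌉) m∸[B+t]≡qr∸t) (m≥n⇒m⊓n≡n falling≤rising)
      where
      m∸[B+t]≡qr∸t : m ∸ (B + t) ≡ q * r ∸ t
      m∸[B+t]≡qr∸t = trans (cong (_∸ (B + t)) m≡A+[1+e]+qr) ([m+n]∸[m+o]≡n∸o B (q * r) t)
      falling≤rising : suc ⌈ q * r ∸ t /r⌉ ≤ ⌈ B + t /r⌉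
      falling≤rising = ≤-trans (s≤s (⌈/r⌉≤ _ q (m∸n≤m (q * r) t)))
        (≤-trans (n≤1+n (suc q)) (<⌈/r⌉ (B + t) (suc q) (≤-trans (m≤m+n A (suc e)) (m≤m+n B t))))

    δ≤D : ∀ c → δ c ≤ D
    δ≤D c with c ≤? D * r
    ... | yes c≤Dr = ≤-trans (m⊓n≤m _ _) (⌈/r⌉≤ c D c≤Dr)
    ... | no c≰Dr = ≤-trans (m⊓n≤n _ _) (s≤s (⌈/r⌉≤ (m ∸ c) (suc q) (m≤n+o⇒m∸n≤o m c (begin
      m                             ≡⟨ m≡A+[1+e]+qr ⟩
      A + suc e + q * r             ≤⟨ +-monoˡ-≤ (q * r) (+-monoʳ-≤ A e<r+r) ⟩
      A + (r + r) + q * r           ≡⟨ rearrange q r ⟩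
      suc (D * r) + suc q * r       ≤⟨ +-monoˡ-≤ (suc q * r) (≰⇒> c≰Dr) ⟩
      c + suc q * r                 ∎))))
      where
      open ≤-Reasoning
      rearrange : ∀ q r → suc (suc q * r) + (r + r) + q * r ≡ suc (suc (suc q) * r) + suc q * r
      rearrange = solve-∀

    δA≡D : δ A ≡ D
    δA≡D = trans (cong δ (sym (+-identityʳ A))) (δ-plateau 0 z<s)

    sum≤m-split : sum< (suc m) δ ≡ sum< A δ + sum< (suc e) (λ t → δ (A + t)) + sum< (suc (q * r)) (λ t → δ (B + t))
    sum≤m-split = begin
      sum< (suc m) δ
        ≡⟨ cong (λ x → sum< x δ) (trans (cong suc m≡A+[1+e]+qr) (sym (+-suc B (q * r)))) ⟩
      sum< (B + suc (q * r)) δ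
        ≡⟨ sum<-+ B (suc (q * r)) δ ⟩
      sum< B δ + sum< (suc (q * r)) (λ t → δ (B + t))
        ≡⟨ cong (_+ sum< (suc (q * r)) (λ t → δ (B + t))) (sum<-+ A (suc e) δ) ⟩
      sum< A δ + sum< (suc e) (λ t → δ (A + t)) + sum< (suc (q * r)) (λ t → δ (B + t)) ∎
      where open ≡-Reasoning

    2*sum-rising : 2 * sum< A δ ≡ r * suc q * D
    2*sum-rising = trans (cong (2 *_) (trans (sum<-cong A δ-rising) (cong (λ x → sum< x ⌈_/r⌉) (+-comm 1 (suc q * r)))))
      (2*sum⌈/r⌉ (suc q))

    sum-plateau : sum< (suc e) (λ t → δ (A + t)) ≡ suc e * D
    sum-plateau = trans (sum<-cong (suc e) δ-plateau) (sum<-const (suc e) D)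

    2*sum-falling : 2 * sum< (suc (q * r)) (λ t → δ (B + t)) ≡ 2 * suc (q * r) + r * q * suc q
    2*sum-falling = begin
      2 * sum< (suc (q * r)) (λ t → δ (B + t))
        ≡⟨ cong (2 *_) (sum<-cong (suc (q * r)) δ-falling) ⟩
      2 * sum< (suc (q * r)) (λ t → suc ⌈ q * r ∸ t /r⌉)
        ≡⟨ cong (2 *_) (sum<-suc (suc (q * r)) (λ t → ⌈ q * r ∸ t /r⌉)) ⟩
      2 * (suc (q * r) + sum< (suc (q * r)) (λ t → ⌈ q * r ∸ t /r⌉))
        ≡⟨ cong (λ x → 2 * (suc (q * r) + x)) (sum<-reverse (q * r) ⌈_/r⌉) ⟩
      2 * (suc (q * r) + sum< (suc (q * r)) ⌈_/r⌉)
        ≡⟨ *-distribˡ-+ 2 (suc (q * r)) _ ⟩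
      2 * suc (q * r) + 2 * sum< (suc (q * r)) ⌈_/r⌉
        ≡⟨ cong (λ x → 2 * suc (q * r) + 2 * sum< x ⌈_/r⌉) (+-comm 1 (q * r)) ⟩
      2 * suc (q * r) + 2 * sum< (q * r + 1) ⌈_/r⌉
        ≡⟨ cong (_+_ (2 * suc (q * r))) (2*sum⌈/r⌉ q) ⟩
      2 * suc (q * r) + r * q * suc q ∎
      where open ≡-Reasoning

    S-closed-form : S + 2 * r * (suc q * suc q) + 2 * D ≡ 2 * m * D + 1
    S-closed-form = suc-injective (begin
      suc (S + 2 * r * (suc q * suc q) + 2 * D)
        ≡⟨ cong (λ x → x + 2 * r * (suc q * suc q) + 2 * D) (trans (+-comm 1 S) S+1≡2*sum≤m) ⟩
      2 * sum< (suc m) δ + 2 * r * (suc q * suc q) + 2 * D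
        ≡⟨ cong (λ x → 2 * x + 2 * r * (suc q * suc q) + 2 * D) sum≤m-split ⟩
      2 * (sum< A δ + sum< (suc e) (λ t → δ (A + t)) + sum< (suc (q * r)) (λ t → δ (B + t))) + 2 * r * (suc q * suc q) + 2 * D
        ≡⟨ cong (λ x → x + 2 * r * (suc q * suc q) + 2 * D) (*-distrib-three 2 (sum< A δ) _ _) ⟩
      2 * sum< A δ + 2 * sum< (suc e) (λ t → δ (A + t)) + 2 * sum< (suc (q * r)) (λ t → δ (B + t)) + 2 * r * (suc q * suc q) + 2 * D
        ≡⟨ cong (λ x → x + 2 * r * (suc q * suc q) + 2 * D)
             (cong₂ _+_ (cong₂ _+_ 2*sum-rising (cong (2 *_) sum-plateau)) 2*sum-falling) ⟩
      r * suc q * D + 2 * (suc e * D) + (2 * suc (q * r) + r * q * suc q) + 2 * r * (suc q * suc q) + 2 * D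
        ≡⟨ polynomial q r e ⟩
      2 * (A + suc e + q * r) * D + 1 + 1
        ≡⟨ cong (λ x → 2 * x * D + 1 + 1) m≡A+[1+e]+qr ⟨
      2 * m * D + 1 + 1
        ≡⟨ +-comm _ 1 ⟩
      suc (2 * m * D + 1) ∎)
      where
      open ≡-Reasoning
      *-distrib-three : ∀ c a b d → c * (a + b + d) ≡ c * a + c * b + c * d
      *-distrib-three = solve-∀
      polynomial : ∀ q r e →
        r * suc q * suc (suc q) + 2 * (suc e * suc (suc q)) + (2 * suc (q * r) + r * q * suc q)
          + 2 * r * (suc q * suc q) + 2 * suc (suc q)
        ≡ 2 * (suc (suc q * r) + suc e + q * r) * suc (suc q) + 1 + 1
      polynomial = solve-∀

    diameter : IsDiam E D
    diameter = (fzero , far , subst (IsDist E fzero far) dist≡D (dist-isDist fzero far))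
             , λ x y d x-y≡d → ≤-trans (proj₂ x-y≡d (dist x y) (proj₁ (dist-isDist x y))) (δ≤D (circ N (toℕ x) (toℕ y)))
      where
      A≤m : A ≤ m
      A≤m = subst (A ≤_) (sym m≡A+[1+e]+qr) (≤-trans (m≤m+n A (suc e)) (m≤m+n B (q * r)))
      A<N : A < N
      A<N = ≤-<-trans A≤m (m<m+n m z<s)
      far : Fin N
      far = fromℕ< A<N
      dist≡D : dist fzero far ≡ D
      dist≡D = begin
        δ (cyc N (toℕ far)) ≡⟨ cong (λ x → δ (cyc N x)) (toℕ-fromℕ< A<N) ⟩
        δ (cyc N A)         ≡⟨ cong δ (cyc-below-half m A A≤m) ⟩
        δ A                 ≡⟨ δA≡D ⟩
        D                   ∎
        where open ≡-Reasoning

  HalfDecomposition : Set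
  HalfDecomposition = ∃[ q ] ∃[ e ] (m ≡ suc (suc q * r) + suc e + q * r) × e < r + r

  decompose : k + 1 < N → HalfDecomposition
  decompose k+1<N = x / (r + r) , x % (r + r) , m≡ , m%n<n x (r + r)
    where
    r+2≤m : r + 2 ≤ m
    r+2≤m = ≮⇒≥ λ m<r+2 → <⇒≱ k+1<N (begin
      m + m             ≤⟨ +-mono-≤ (m≤r+1 m<r+2) (m≤r+1 m<r+2) ⟩
      r + 1 + (r + 1)   ≡⟨ regroup r ⟩
      k + 1             ∎)
      where
      open ≤-Reasoning
      m≤r+1 : m < r + 2 → m ≤ r + 1
      m≤r+1 m<r+2 = s≤s⁻¹ (subst (m <_) (+-suc r 1) m<r+2)
      regroup : ∀ r → r + 1 + (r + 1) ≡ suc (r + r) + 1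
      regroup = solve-∀
    x = m ∸ (r + 2)
    regroup : ∀ r q e → r + 2 + (e + q * (r + r)) ≡ suc (suc q * r) + suc e + q * r
    regroup = solve-∀
    m≡ : m ≡ suc (suc (x / (r + r)) * r) + suc (x % (r + r)) + x / (r + r) * r
    m≡ = trans (sym (m+[n∸m]≡n r+2≤m))
      (trans (cong (_+_ (r + 2)) (m≡m%n+[m/n]*n x (r + r))) (regroup r (x / (r + r)) (x % (r + r))))

  harD≡D : ∀ q e → m ≡ suc (suc q * r) + suc e + q * r → e < r + r → harD N k ≡ suc (suc q)
  harD≡D q e m≡ e<r+r = begin
    (N ∸ k ∸ 3) / (2 * (r + r)) + 2 ≡⟨ cong (λ x → x / (2 * (r + r)) + 2) N∸k∸3≡ ⟩
    (2 * e + q * (2 * (r + r))) / (2 * (r + r)) + 2 ≡⟨ cong (_+ 2) ([m+n*o]/o≡n (2 * e) q (2 * (r + r)) (*-monoʳ-< 2 e<r+r)) ⟩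
    q + 2                                         ≡⟨ +-comm q 2 ⟩
    suc (suc q)                                   ∎
    where
    open ≡-Reasoning
    regroup : ∀ r q e → let m = suc (suc q * r) + suc e + q * r in m + m ≡ suc (r + r) + 3 + (2 * e + q * (2 * (r + r)))
    regroup = solve-∀
    N∸k∸3≡ : N ∸ k ∸ 3 ≡ 2 * e + q * (2 * (r + r))
    N∸k∸3≡ = trans (∸-+-assoc N k 3) (m≡n+o⇒m∸n≡o (k + 3) (trans (cong₂ _+_ m≡ m≡) (regroup r q e)))

  small-regime⇒q≡0 : ∀ q e → m ≡ suc (suc q * r) + suc e + q * r → N ≤ 3 * k ∸ 1 → q ≡ 0
  small-regime⇒q≡0 zero    e m≡ N≤3k∸1 = refl
  small-regime⇒q≡0 (suc q) e m≡ N≤3k∸1 = ⊥-elim (<⇒≱ (begin-strict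
    3 * k ∸ 1                        <⟨ m≤m+n (suc (3 * k ∸ 1)) _ ⟩
    suc (3 * k ∸ 1) + suc (2 * e + 4 * q * r) ≡⟨ regroup r q e ⟨
    m′ + m′                          ≡⟨ cong₂ _+_ m≡ m≡ ⟨
    N                                ∎) N≤3k∸1)
    where
    open ≤-Reasoning
    m′ = suc (suc (suc q) * r) + suc e + suc q * r
    regroup : ∀ r q e → let m′ = suc (suc (suc q) * r) + suc e + suc q * r in
      m′ + m′ ≡ suc ((r + r) + 2 * suc (r + r)) + suc (2 * e + 4 * q * r)
    regroup = solve-∀

  large-regime⇒1≤q : ∀ q e → m ≡ suc (suc q * r) + suc e + q * r → e < r + r → 3 * k + 1 ≤ N → 1 ≤ q
  large-regime⇒1≤q (suc q) e m≡ e<r+r 3k+1≤N = s≤s z≤n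
  large-regime⇒1≤q zero    e m≡ e<r+r 3k+1≤N = ⊥-elim (<⇒≱ (begin-strict
    N                         ≡⟨ cong₂ _+_ m≡ m≡ ⟩
    m′ + m′                       ≡⟨ regroup r e ⟩
    (2 * r + 2) + 2 * suc e       ≤⟨ +-monoʳ-≤ (2 * r + 2) (*-monoʳ-≤ 2 e<r+r) ⟩
    (2 * r + 2) + 2 * (r + r)     <⟨ m<m+n _ z<s ⟩
    (2 * r + 2) + 2 * (r + r) + 2 ≡⟨ 6r+4≡3k+1 r ⟩
    3 * k + 1                     ∎) 3k+1≤N)
    where
    open ≤-Reasoning
    m′ = suc (1 * r) + suc e + 0 * r
    regroup : ∀ r e → let m′ = suc (1 * r) + suc e + 0 * r in m′ + m′ ≡ (2 * r + 2) + 2 * suc e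
    regroup = solve-∀
    6r+4≡3k+1 : ∀ r → (2 * r + 2) + 2 * (r + r) + 2 ≡ 3 * suc (r + r) + 1
    6r+4≡3k+1 = solve-∀

  small-case : k + 1 < N → N ≤ 3 * k ∸ 1 →
    IsDiam E 2 × (∀ x → IsStatus E x (2 * N ∸ k ∸ 2)) × (∃[ W ] IsWiener E W × 2 * W ≡ N * (2 * N ∸ k ∸ 2))
  small-case k+1<N N≤3k∸1 with decompose k+1<N
  ... | q , e , m≡ , e<r+r with small-regime⇒q≡0 q e m≡ N≤3k∸1
  ...   | refl = diameter , (λ x → subst (IsStatus E x) S≡ (status x)) , W , wiener , trans 2W≡NS (cong (N *_) S≡)
    where
    open ClosedForm 0 e m≡ e<r+r
    S≡ : S ≡ 2 * N ∸ k ∸ 2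
    S≡ = status-for-D≡2 r m S S-closed-form

  large-case : k + 1 < N → 3 * k + 1 ≤ N →
    3 ≤ harD N k × IsDiam E (harD N k)
    × (∀ x → ∃[ S ] IsStatus E x S × StatusFormula N k (harD N k) S)
    × (∃[ W ] IsWiener E W × WienerFormula N k (harD N k) W)
  large-case k+1<N 3k+1≤N with decompose k+1<N
  ... | q , e , m≡ , e<r+r rewrite harD≡D q e m≡ e<r+r =
    s≤s (s≤s (large-regime⇒1≤q q e m≡ e<r+r 3k+1≤N)) , diameter
    , (λ x → S , status x , S-formula) , W , wiener , wiener-formula N k D S W 2W≡NS S-formula
    where
    open ClosedForm q e m≡ e<r+r
    S-formula : StatusFormula N k D S
    S-formula = status-formula r m q S S-closed-form

lemma3p2 : (n k : ℕ) → k + 1 < n → 3 ≤ k → ¬ (2 ∣ k) → 2 ∣ n →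
    ((k + 1 < n → n ≤ 3 * k ∸ 1 →
        IsDiam (HararyAdj k n) 2
        × (∀ (x : Fin n) → IsStatus (HararyAdj k n) x (2 * n ∸ k ∸ 2))
        × (∃[ W ] IsWiener (HararyAdj k n) W × 2 * W ≡ n * (2 * n ∸ k ∸ 2)))
    × (3 * k + 1 ≤ n →
        3 ≤ harD n k
        × IsDiam (HararyAdj k n) (harD n k)
        × (∀ (x : Fin n) → ∃[ S ] IsStatus (HararyAdj k n) x S ×
             + 2 *ℤ + S ≡ + harD n k *ℤ (+ (2 * n + 4 * k) -ℤ + 8 -ℤ + (2 * (k ∸ 1) * harD n k)) -ℤ + 2 *ℤ (+ k -ℤ + 2))
        × (∃[ W ] IsWiener (HararyAdj k n) W ×
             + 4 *ℤ + W ≡ + n *ℤ + harD n k *ℤ (+ (2 * n + 4 * k) -ℤ + 8 -ℤ + (2 * (k ∸ 1) * harD n k)) -ℤ + 2 *ℤ + n *ℤ (+ k -ℤ + 2))))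
lemma3p2 n k k+1<n 3≤k k-odd n-even with odd≥3-form k 3≤k k-odd | even>0-form n (≤-<-trans z≤n k+1<n) n-even
... | r′ , refl | m₀ , refl = (λ _ → small-case k+1<n) , large-case k+1<n
  where open Harary r′ m₀
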